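{- Let $q$ be an odd prime power and $n\ge 1$. Let $A\subseteq\mathbb{F}_q^n$ be such that there do not exist three distinct elements $x,y,z\in A$ with $\langle z-x,y-x\rangle=0$. Then $|A|\le\binom{n+q}{q-1}+3$.
   Context: $\langle u,v\rangle=\sum_{i=1}^n u_iv_i\in\mathbb{F}_q$ denotes the standard bilinear inner product on $\mathbb{F}_q^n$. -}

module Defs where

open import Level using (0ℓ)
open import Data.Nat using (ℕ; _^_; _≤_)
open import Data.Nat.Primality using (Prime)
open import Data.Fin using (Fin)
open import Data.Product using (Σ; ∃; _×_)
open import Relation.Nullary using (¬_)
open import Relation.Binary.PropositionalEquality using (_≡_)
import Relation.Binary.PropositionalEquality as P
open import Algebra.Bundles using (CommutativeRing)
open import Function.Bundles using (Inverse)
open import Data.List using (List; length)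
import Data.List.Relation.Unary.Unique.Setoid as USetoid
import Data.List.Membership.Setoid as MSetoid
import Data.Vec.Functional.Relation.Binary.Pointwise.Properties as PWP

IsPrimePower : ℕ → Set
IsPrimePower q = Σ ℕ λ p → Σ ℕ λ k → Prime p × (1 ≤ k) × (q ≡ p ^ k)

IsField : CommutativeRing 0ℓ 0ℓ → Set
IsField R = (¬ (0# ≈ 1#)) × (∀ x → ¬ (x ≈ 0#) → ∃ λ y → x * y ≈ 1#)
  where open CommutativeRing R

HasSize : CommutativeRing 0ℓ 0ℓ → ℕ → Set
HasSize R q = Inverse (P.setoid (Fin q)) (CommutativeRing.setoid R)

module VectorSpace (R : CommutativeRing 0ℓ 0ℓ) (n : ℕ) where
  open CommutativeRing R

  Vec : Set
  Vec = Fin n → Carrier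

  VecSetoid = PWP.setoid setoid n

  _≈ᵥ_ : Vec → Vec → Set
  u ≈ᵥ v = ∀ i → u i ≈ v i

  _-ᵥ_ : Vec → Vec → Vec
  (u -ᵥ v) i = u i - v i

  sumF : (m : ℕ) → (Fin m → Carrier) → Carrier
  sumF ℕ.zero f = 0#
  sumF (ℕ.suc m) f = f Fin.zero + sumF m (λ i → f (Fin.suc i))

  ⟨_,_⟩ : Vec → Vec → Carrier
  ⟨ u , v ⟩ = sumF n (λ i → u i * v i)

  open MSetoid VecSetoid public using (_∈_)
  open USetoid VecSetoid public using (Unique)

  NoRightAngle : List Vec → Set
  NoRightAngle A = ∀ x y z → x ∈ A → y ∈ A → z ∈ A →
    ¬ (x ≈ᵥ y) → ¬ (y ≈ᵥ z) → ¬ (x ≈ᵥ z) → ¬ (⟨ z -ᵥ x , y -ᵥ x ⟩ ≈ 0#)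

-- Fix y ∈ A. For every other a ∈ A, the function x ↦ χ₀ ⟨y - x, a - x⟩ with χ₀ s = ∏_{c ≠ 0} (s - c) is nonzero at
-- x = a and, as A has no right angle, zero at all other points of A ∖ {y}. Since ⟨y - x, a - x⟩ is affine in
-- (⟨x,x⟩, x) ∈ F^(n+1), these are polynomials of degree ≤ q - 1 in n + 1 variables evaluated at the lifted points,
-- and their diagonal evaluation pattern makes them linearly independent. Hence |A| - 1 ≤ C(n + q, q - 1).
module Submission where

open import Level using (0ℓ)
open import Data.Nat as ℕ using (ℕ; zero; suc; s≤s; z≤n)
import Data.Nat.Properties as ℕ
open import Data.Nat.Combinatorics using (_C_; nCn≡1; nCk+nC[k+1]≡[n+1]C[k+1])
open import Data.Fin using (Fin; zero; suc; punchIn; punchOut; _≟_)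
open import Data.Fin.Properties using (any?; suc-injective; punchInᵢ≢i; punchIn-punchOut)
open import Data.Vec.Functional as Vector using (Vector; _++_; tail; head; insertAt)
open import Data.Vec.Functional.Properties using (insertAt-lookup; insertAt-punchIn)
import Data.Vec.Functional.Relation.Unary.All as Allᵥ
import Data.Vec.Functional.Relation.Unary.All.Properties as Allᵥ
open import Data.List using (List; []; _∷_; lookup; length)
import Data.List.Relation.Unary.AllPairs as AllPairs
open import Data.List.Relation.Unary.Unique.Setoid.Properties using (Unique[x∷xs]⇒x∉xs)
open import Data.List.Membership.Setoid.Properties using (∈-lookup; ∈-resp-≈)
open import Data.Product using (Σ; ∃; _×_; _,_; proj₁; proj₂)
open import Data.Empty using (⊥-elim)
open import Function using (_∘_)
open import Function.Bundles using (Inverse; Injection)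
open import Function.Properties.Inverse using (Inverse⇒Injection)
import Function.Construct.Symmetry as Symmetry
open import Relation.Nullary using (¬_; Dec; yes; no; ¬?)
open import Relation.Nullary.Decidable using (decidable-stable; via-injection)
open import Relation.Binary.Bundles using (Setoid)
open import Relation.Binary.PropositionalEquality as ≡ using (_≡_; _≢_)
open import Algebra.Bundles using (CommutativeRing)
open import Defs

module LinearAlgebra (R : CommutativeRing 0ℓ 0ℓ) where
  open CommutativeRing R hiding (zero)
  open import Algebra.Properties.Semiring.Sum semiring
  open import Algebra.Properties.CommutativeSemigroup *-commutativeSemigroup using (x∙yz≈y∙xz)
  open import Algebra.Properties.Ring ring using (-‿distribˡ-*; -‿distribʳ-*)
  open import Relation.Binary.Reasoning.Setoid setoid
  open import Algebra.Solver.Ring.NaturalCoefficients.Default commutativeSemiring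
    using (solve; _:=_; _:+_; _:*_)

  ∑-zero : ∀ {N} (t : Vector Carrier N) → (∀ i → t i ≈ 0#) → ∑[ i < N ] t i ≈ 0#
  ∑-zero {N} t t≈0 = trans (sum-cong-≋ t≈0) (sum-replicate-zero N)

  ∑-single : ∀ {N} (t : Vector Carrier N) a → (∀ b → b ≢ a → t b ≈ 0#) → ∑[ i < N ] t i ≈ t a
  ∑-single {suc N} t a off = begin
    sum t                                 ≈⟨ sum-remove {i = a} t ⟩
    t a + ∑[ l < N ] t (punchIn a l)      ≈⟨ +-congˡ (∑-zero _ (λ l → off _ (punchInᵢ≢i a l))) ⟩
    t a + 0#                              ≈⟨ +-identityʳ (t a) ⟩
    t a                                   ∎

  ∑-insertAt : ∀ {N} (u : Vector Carrier (suc N)) (w : Vector Carrier N) k v →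
    ∑[ i < suc N ] (u i * insertAt w k v i) ≈ u k * v + ∑[ l < N ] (u (punchIn k l) * w l)
  ∑-insertAt {N} u w k v = trans (sum-remove {i = k} (λ i → u i * insertAt w k v i))
    (+-cong (*-congˡ (reflexive (insertAt-lookup w k v)))
            (sum-cong-≋ {N} (λ l → *-congˡ (reflexive (insertAt-punchIn w k v l)))))

  ∑-combination : ∀ {N} a b (u v w : Vector Carrier N) →
    ∑[ l < N ] ((a * u l + b * v l) * w l) ≈ a * ∑[ l < N ] (u l * w l) + b * ∑[ l < N ] (v l * w l)
  ∑-combination {N} a b u v w = begin
    ∑[ l < N ] ((a * u l + b * v l) * w l)               ≈⟨ sum-cong-≋ {N} (λ l → expand a b (u l) (v l) (w l)) ⟩
    ∑[ l < N ] (a * (u l * w l) + b * (v l * w l))       ≈⟨ ∑-distrib-+ (λ l → a * (u l * w l)) (λ l → b * (v l * w l)) ⟩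
    ∑[ l < N ] (a * (u l * w l)) + ∑[ l < N ] (b * (v l * w l))
      ≈⟨ +-cong (*-distribˡ-sum a (λ l → u l * w l)) (*-distribˡ-sum b (λ l → v l * w l)) ⟨
    a * ∑[ l < N ] (u l * w l) + b * ∑[ l < N ] (v l * w l) ∎
    where
    expand : ∀ a b x y z → (a * x + b * y) * z ≈ a * (x * z) + b * (y * z)
    expand = solve 5 (λ a b x y z → (a :* x :+ b :* y) :* z := a :* (x :* z) :+ b :* (y :* z)) refl

  data Span {X : Set} {D : ℕ} (g : Vector (X → Carrier) D) : (X → Carrier) → Set where
    gen   : ∀ j → Span g (g j)
    null  : Span g (λ _ → 0#)
    add   : ∀ {f f′} → Span g f → Span g f′ → Span g (λ x → f x + f′ x)
    scale : ∀ {f} c → Span g f → Span g (λ x → c * f x)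
    resp  : ∀ {f f′} → (∀ x → f x ≈ f′ x) → Span g f → Span g f′

  private variable
    X Y : Set
    D E : ℕ
    g : Vector (X → Carrier) D
    h : Vector (X → Carrier) E
    f : X → Carrier

  Span-bind : Allᵥ.All (Span h) g → Span g f → Span h f
  Span-bind h∋g (gen j)     = h∋g j
  Span-bind h∋g null        = null
  Span-bind h∋g (add p p′)  = add (Span-bind h∋g p) (Span-bind h∋g p′)
  Span-bind h∋g (scale c p) = scale c (Span-bind h∋g p)
  Span-bind h∋g (resp e p)  = resp e (Span-bind h∋g p)

  Span-*ˡ : ∀ (φ : X → Carrier) → Allᵥ.All (λ gⱼ → Span h (λ x → φ x * gⱼ x)) g →
            Span g f → Span h (λ x → φ x * f x)
  Span-*ˡ φ h∋φg (gen j)     = h∋φg j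
  Span-*ˡ φ h∋φg null        = resp (λ x → sym (zeroʳ (φ x))) null
  Span-*ˡ φ h∋φg (add p p′)  = resp (λ x → sym (distribˡ (φ x) _ _)) (add (Span-*ˡ φ h∋φg p) (Span-*ˡ φ h∋φg p′))
  Span-*ˡ φ h∋φg (scale c p) = resp (λ x → x∙yz≈y∙xz c (φ x) _) (scale c (Span-*ˡ φ h∋φg p))
  Span-*ˡ φ h∋φg (resp e p)  = resp (λ x → *-congˡ (e x)) (Span-*ˡ φ h∋φg p)

  Span-∘ : ∀ (φ : Y → X) → Span g f → Span (λ j → g j ∘ φ) (f ∘ φ)
  Span-∘ φ (gen j)     = gen j
  Span-∘ φ null        = null
  Span-∘ φ (add p p′)  = add (Span-∘ φ p) (Span-∘ φ p′)
  Span-∘ φ (scale c p) = scale c (Span-∘ φ p)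
  Span-∘ φ (resp e p)  = resp (e ∘ φ) (Span-∘ φ p)

  Span-∑ : ∀ {K} (t : Fin K → X → Carrier) → (∀ i → Span g (t i)) → Span g (λ x → ∑[ i < K ] t i x)
  Span-∑ {K = zero}  t g∋t = null
  Span-∑ {K = suc K} t g∋t = add (g∋t zero) (Span-∑ (t ∘ suc) (g∋t ∘ suc))

  Span-annihilated : ∀ {N} (p : Fin N → X) (w : Vector Carrier N) →
    (∀ j → ∑[ b < N ] (g j (p b) * w b) ≈ 0#) → Span g f → ∑[ b < N ] (f (p b) * w b) ≈ 0#
  Span-annihilated p w g⊥w (gen j) = g⊥w j
  Span-annihilated p w g⊥w null = ∑-zero _ (λ b → zeroˡ (w b))
  Span-annihilated {N = N} p w g⊥w (add {f} {f′} s s′) = begin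
    ∑[ b < N ] ((f (p b) + f′ (p b)) * w b)                      ≈⟨ sum-cong-≋ {N} (λ b → distribʳ (w b) _ _) ⟩
    ∑[ b < N ] (f (p b) * w b + f′ (p b) * w b)                  ≈⟨ ∑-distrib-+ (λ b → f (p b) * w b) (λ b → f′ (p b) * w b) ⟩
    ∑[ b < N ] (f (p b) * w b) + ∑[ b < N ] (f′ (p b) * w b)    ≈⟨ +-cong (Span-annihilated p w g⊥w s) (Span-annihilated p w g⊥w s′) ⟩
    0# + 0#                                                      ≈⟨ +-identityˡ 0# ⟩
    0#                                                           ∎
  Span-annihilated {N = N} p w g⊥w (scale {f} c s) = begin
    ∑[ b < N ] (c * f (p b) * w b)      ≈⟨ sum-cong-≋ {N} (λ b → *-assoc c _ _) ⟩
    ∑[ b < N ] (c * (f (p b) * w b))    ≈⟨ *-distribˡ-sum c (λ b → f (p b) * w b) ⟨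
    c * ∑[ b < N ] (f (p b) * w b)      ≈⟨ *-congˡ (Span-annihilated p w g⊥w s) ⟩
    c * 0#                              ≈⟨ zeroʳ c ⟩
    0#                                  ∎
  Span-annihilated {N = N} p w g⊥w (resp e s) =
    trans (sum-cong-≋ {N} (λ b → *-congʳ (sym (e (p b))))) (Span-annihilated p w g⊥w s)

  module _ (≈0? : ∀ x → Dec (x ≈ 0#)) (1≉0 : 1# ≉ 0#)
           (*-nonzero : ∀ {x y} → x ≉ 0# → y ≉ 0# → x * y ≉ 0#) where

    Solves : ∀ {D N} → (Fin D → Fin N → Carrier) → Vector Carrier N → Set
    Solves {N = N} M w = ∀ j → ∑[ i < N ] (M j i * w i) ≈ 0#

    NontrivialSolution : ∀ {D N} → (Fin D → Fin N → Carrier) → Set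
    NontrivialSolution {N = N} M = Σ (Vector Carrier N) λ w → (∃ λ i → w i ≉ 0#) × Solves M w

    solution-of-zero-row : ∀ {D N} (M : Fin (suc D) → Fin N → Carrier) →
      (∀ i → M zero i ≈ 0#) → NontrivialSolution (M ∘ suc) → NontrivialSolution M
    solution-of-zero-row {N = N} M row₀≈0 (w , w≉0 , solves) = w , w≉0 , λ where
      zero    → ∑-zero _ (λ i → trans (*-congʳ (row₀≈0 i)) (zeroˡ (w i)))
      (suc j) → solves j

    -- Fraction-free Gaussian elimination of the pivot M₀ₖ, so that no inverses are needed.
    eliminate : ∀ {D N} → (Fin (suc D) → Fin (suc N) → Carrier) → Fin (suc N) → Fin D → Fin N → Carrier
    eliminate M k j l = M zero k * M (suc j) (punchIn k l) + - M (suc j) k * M zero (punchIn k l)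

    back-substitute : ∀ {D N} (M : Fin (suc D) → Fin (suc N) → Carrier) k → M zero k ≉ 0# →
      NontrivialSolution (eliminate M k) → NontrivialSolution M
    back-substitute {D} {N} M k c≉0 (w′ , (i , w′ᵢ≉0) , solves) = w , (punchIn k i , wᵢ≉0) , rows
      where
      c : Carrier
      c = M zero k
      T : Fin (suc D) → Carrier
      T r = ∑[ l < N ] (M r (punchIn k l) * w′ l)
      w : Vector Carrier (suc N)
      w = insertAt (λ l → c * w′ l) k (- T zero)

      wᵢ≉0 : w (punchIn k i) ≉ 0#
      wᵢ≉0 e = *-nonzero c≉0 w′ᵢ≉0 (trans (sym (reflexive (insertAt-punchIn (λ l → c * w′ l) k (- T zero) i))) e)

      row : ∀ r → ∑[ i < suc N ] (M r i * w i) ≈ M r k * - T zero + c * T r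
      row r = trans (∑-insertAt (M r) (λ l → c * w′ l) k (- T zero))
        (+-congˡ (trans (sum-cong-≋ {N} (λ l → x∙yz≈y∙xz (M r (punchIn k l)) c (w′ l)))
                        (sym (*-distribˡ-sum c (λ l → M r (punchIn k l) * w′ l)))))

      rows : Solves M w
      rows zero = begin
        ∑[ i < suc N ] (M zero i * w i)   ≈⟨ row zero ⟩
        c * - T zero + c * T zero         ≈⟨ distribˡ c _ _ ⟨
        c * (- T zero + T zero)           ≈⟨ *-congˡ (-‿inverseˡ (T zero)) ⟩
        c * 0#                            ≈⟨ zeroʳ c ⟩
        0#                                ∎
      rows (suc j) = begin
        ∑[ i < suc N ] (M (suc j) i * w i)           ≈⟨ row (suc j) ⟩
        M (suc j) k * - T zero + c * T (suc j)       ≈⟨ +-comm _ _ ⟩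
        c * T (suc j) + M (suc j) k * - T zero       ≈⟨ +-congˡ (trans (sym (-‿distribʳ-* _ _)) (-‿distribˡ-* _ _)) ⟩
        c * T (suc j) + - M (suc j) k * T zero       ≈⟨ ∑-combination c (- M (suc j) k) (λ l → M (suc j) (punchIn k l)) (λ l → M zero (punchIn k l)) w′ ⟨
        ∑[ l < N ] (eliminate M k j l * w′ l)        ≈⟨ solves j ⟩
        0#                                           ∎

    homogeneous-solution : ∀ {D N} → D ℕ.< N → (M : Fin D → Fin N → Carrier) → NontrivialSolution M
    homogeneous-solution {zero}  {suc N} _ M = (λ _ → 1#) , (zero , 1≉0) , λ ()
    homogeneous-solution {suc D} {suc N} (s≤s D<N) M with any? (λ i → ¬? (≈0? (M zero i)))
    ... | yes (k , Mₖ≉0) = back-substitute M k Mₖ≉0 (homogeneous-solution D<N (eliminate M k))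
    ... | no  no-pivot   = solution-of-zero-row M row₀≈0 (homogeneous-solution (ℕ.m<n⇒m<1+n D<N) (M ∘ suc))
      where
      row₀≈0 : ∀ i → M zero i ≈ 0#
      row₀≈0 i = decidable-stable (≈0? (M zero i)) (λ Mᵢ≉0 → no-pivot (i , Mᵢ≉0))

    diagonal-bound : ∀ {N} (g : Vector (X → Carrier) D) (f : Fin N → X → Carrier) (p : Fin N → X) →
      (∀ a → Span g (f a)) → (∀ a b → b ≢ a → f a (p b) ≈ 0#) → (∀ a → f a (p a) ≉ 0#) → N ℕ.≤ D
    diagonal-bound {D = D} {N = N} g f p g∋f off diag with D ℕ.<? N
    ... | no  D≮N = ℕ.≮⇒≥ D≮N
    ... | yes D<N with homogeneous-solution D<N (λ j b → g j (p b))
    ...   | w , (a , wₐ≉0) , g⊥w = ⊥-elim (*-nonzero (diag a) wₐ≉0 (begin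
      f a (p a) * w a                 ≈⟨ ∑-single (λ b → f a (p b) * w b) a (λ b b≢a → trans (*-congʳ (off a b b≢a)) (zeroˡ (w b))) ⟨
      ∑[ b < N ] (f a (p b) * w b)    ≈⟨ Span-annihilated p w g⊥w (g∋f a) ⟩
      0#                              ∎))

module Polynomials (R : CommutativeRing 0ℓ 0ℓ) where
  open CommutativeRing R hiding (zero)
  open import Algebra.Properties.Semiring.Sum semiring
  open import Algebra.Properties.CommutativeMonoid.Sum *-commutativeMonoid using () renaming (sum to ∏)
  open import Algebra.Properties.CommutativeSemigroup *-commutativeSemigroup using (x∙yz≈y∙xz)
  open import Algebra.Properties.CommutativeSemigroup +-commutativeSemigroup using (xy∙z≈xz∙y)
  open LinearAlgebra R using (Span; gen; add; scale; resp; Span-bind; Span-*ˡ; Span-∘; Span-∑)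

  monomialCount : ℕ → ℕ → ℕ
  monomialCount zero    d       = 1
  monomialCount (suc m) zero    = 1
  monomialCount (suc m) (suc d) = monomialCount m (suc d) ℕ.+ monomialCount (suc m) d

  -- Monomials of degree ≤ d + 1 either avoid x₀, or are x₀ times a monomial of degree ≤ d.
  monomial : ∀ m d → Vector ((Fin m → Carrier) → Carrier) (monomialCount m d)
  monomial zero    d       _ _ = 1#
  monomial (suc m) zero    _ _ = 1#
  monomial (suc m) (suc d)     = (λ j → monomial m (suc d) j ∘ tail) ++ (λ j x → head x * monomial (suc m) d j x)

  monomialCount≡C : ∀ m d → monomialCount m d ≡ (m ℕ.+ d) C d
  monomialCount≡C zero    d       = ≡.sym (nCn≡1 d)
  monomialCount≡C (suc m) zero    = ≡.refl
  monomialCount≡C (suc m) (suc d) = begin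
    monomialCount m (suc d) ℕ.+ monomialCount (suc m) d   ≡⟨ ≡.cong₂ ℕ._+_ (monomialCount≡C m (suc d)) (monomialCount≡C (suc m) d) ⟩
    (m ℕ.+ suc d) C suc d ℕ.+ (suc m ℕ.+ d) C d           ≡⟨ ≡.cong (λ n → n C suc d ℕ.+ (suc m ℕ.+ d) C d) (ℕ.+-suc m d) ⟩
    (suc m ℕ.+ d) C suc d ℕ.+ (suc m ℕ.+ d) C d           ≡⟨ ℕ.+-comm ((suc m ℕ.+ d) C suc d) _ ⟩
    (suc m ℕ.+ d) C d ℕ.+ (suc m ℕ.+ d) C suc d           ≡⟨ nCk+nC[k+1]≡[n+1]C[k+1] (suc m ℕ.+ d) d ⟩
    suc (suc m ℕ.+ d) C suc d                              ≡⟨ ≡.cong (λ n → suc n C suc d) (ℕ.+-suc m d) ⟨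
    (suc m ℕ.+ suc d) C suc d                              ∎
    where open ≡.≡-Reasoning

  Poly : ∀ m → ℕ → ((Fin m → Carrier) → Carrier) → Set
  Poly m d = Span (monomial m d)

  monomial-tail : ∀ m d → Allᵥ.All (λ g → Poly (suc m) d (g ∘ tail)) (monomial m d)
  monomial-tail zero    zero    _ = gen zero
  monomial-tail (suc m) zero    _ = gen zero
  monomial-tail m       (suc d)   = Allᵥ.++⁻ˡ (Poly (suc m) (suc d)) _ gen

  Poly-tail : ∀ {m d f} → Poly m d f → Poly (suc m) d (f ∘ tail)
  Poly-tail {m} {d} p = Span-bind (monomial-tail m d) (Span-∘ tail p)

  Poly-1 : ∀ m d → Poly m d (λ _ → 1#)
  Poly-1 zero    d       = gen zero
  Poly-1 (suc m) zero    = gen zero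
  Poly-1 (suc m) (suc d) = Poly-tail (Poly-1 m (suc d))

  Poly-*x₀ : ∀ {m d f} → Poly (suc m) d f → Poly (suc m) (suc d) (λ x → head x * f x)
  Poly-*x₀ {m} {d} = Span-*ˡ head (Allᵥ.++⁻ʳ (Poly (suc m) (suc d)) (λ j → monomial m (suc d) j ∘ tail) gen)

  monomial-raise : ∀ m d → Allᵥ.All (Poly m (suc d)) (monomial m d)
  monomial-raise zero    d       _ = gen zero
  monomial-raise (suc m) zero    _ = Poly-1 (suc m) 1
  monomial-raise (suc m) (suc d)   = Allᵥ.++⁺ (Poly (suc m) (suc (suc d)))
    (λ j → Poly-tail (monomial-raise m (suc d) j)) (λ j → Poly-*x₀ (monomial-raise (suc m) d j))

  Poly-raise : ∀ {m d f} → Poly m d f → Poly m (suc d) f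
  Poly-raise {m} {d} = Span-bind (monomial-raise m d)

  monomial-*x : ∀ m d (i : Fin m) → Allᵥ.All (λ g → Poly m (suc d) (λ x → x i * g x)) (monomial m d)
  Poly-*x : ∀ {m d f} (i : Fin m) → Poly m d f → Poly m (suc d) (λ x → x i * f x)

  monomial-*x (suc m) d       zero    j = Poly-*x₀ (gen j)
  monomial-*x (suc m) zero    (suc i) _ = Poly-tail (Poly-*x i (Poly-1 m zero))
  monomial-*x (suc m) (suc d) (suc i)   =
    Allᵥ.++⁺ (λ g → Poly (suc m) (suc (suc d)) (λ x → x (suc i) * g x))
             {xs = λ j → monomial m (suc d) j ∘ tail} {ys = λ j x → head x * monomial (suc m) d j x}
    (λ j → Poly-tail (monomial-*x m (suc d) i j))
    (λ j → resp (λ x → x∙yz≈y∙xz (head x) (x (suc i)) _) (Poly-*x₀ (monomial-*x (suc m) d (suc i) j)))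

  Poly-*x {m} {d} i = Span-*ˡ (λ x → x i) (monomial-*x m d i)

  affine : ∀ {m} → Vector Carrier m → Carrier → (Fin m → Carrier) → Carrier
  affine {m} α β x = β + ∑[ i < m ] (α i * x i)

  Poly-*affine : ∀ {m d f} α β → Poly m d f → Poly m (suc d) (λ x → affine α β x * f x)
  Poly-*affine {m} {d} {f} α β p =
    resp expand (add (scale β (Poly-raise p)) (Span-∑ (λ i x → α i * (x i * f x)) (λ i → scale (α i) (Poly-*x i p))))
    where
    expand : ∀ x → β * f x + ∑[ i < m ] (α i * (x i * f x)) ≈ affine α β x * f x
    expand x = trans (+-congˡ (trans (sum-cong-≋ {m} (λ i → sym (*-assoc (α i) (x i) (f x))))
                                     (sym (*-distribʳ-sum (f x) (λ i → α i * x i)))))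
                     (sym (distribʳ (f x) β _))

  Poly-∏affine : ∀ {m k} α β (c : Vector Carrier k) → Poly m k (λ x → ∏ (λ i → affine α β x - c i))
  Poly-∏affine {m} {zero}  α β c = Poly-1 m zero
  Poly-∏affine {m} {suc k} α β c = resp (λ x → *-congʳ (xy∙z≈xz∙y β (- c zero) _))
    (Poly-*affine α (β - c zero) (Poly-∏affine α β (c ∘ suc)))

module _ {c ℓ} (S : Setoid c ℓ) where
  open Setoid S using (_≈_; sym)
  open import Data.List.Relation.Unary.Unique.Setoid S using (Unique)

  lookup-injective : ∀ {xs} → Unique xs → ∀ {i j} → lookup xs i ≈ lookup xs j → i ≡ j
  lookup-injective {x ∷ xs} uniq {zero}  {zero}  _ = ≡.refl
  lookup-injective {x ∷ xs} uniq {zero}  {suc j} e = ⊥-elim (Unique[x∷xs]⇒x∉xs S uniq (∈-resp-≈ S (sym e) (∈-lookup S xs j)))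
  lookup-injective {x ∷ xs} uniq {suc i} {zero}  e = ⊥-elim (Unique[x∷xs]⇒x∉xs S uniq (∈-resp-≈ S e (∈-lookup S xs i)))
  lookup-injective {x ∷ xs} (_ AllPairs.∷ uniq) {suc i} {suc j} e = ≡.cong suc (lookup-injective uniq e)

module FiniteField (R : CommutativeRing 0ℓ 0ℓ) (isField : IsField R) {q} (size : HasSize R (suc q)) where
  open CommutativeRing R hiding (zero)
  open import Algebra.Properties.CommutativeMonoid.Sum *-commutativeMonoid using () renaming (sum to ∏; sum-remove to ∏-remove)
  open import Algebra.Properties.Group +-group using (x∙y⁻¹≈ε⇒x≈y)
  open import Relation.Binary.Reasoning.Setoid setoid
  private module size = Inverse size

  private
    from-injection : Injection setoid (≡.setoid (Fin (suc q)))
    from-injection = Inverse⇒Injection (Symmetry.inverse size)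

  ≈0? : ∀ x → Dec (x ≈ 0#)
  ≈0? x = via-injection from-injection _≟_ x 0#

  1≉0 : 1# ≉ 0#
  1≉0 1≈0 = proj₁ isField (sym 1≈0)

  *-nonzero : ∀ {x y} → x ≉ 0# → y ≉ 0# → x * y ≉ 0#
  *-nonzero {x} {y} x≉0 y≉0 xy≈0 with proj₂ isField x x≉0
  ... | x⁻¹ , xx⁻¹≈1 = y≉0 (begin
    y                ≈⟨ *-identityˡ y ⟨
    1# * y           ≈⟨ *-congʳ (trans (sym xx⁻¹≈1) (*-comm x x⁻¹)) ⟩
    x⁻¹ * x * y      ≈⟨ *-assoc x⁻¹ x y ⟩
    x⁻¹ * (x * y)    ≈⟨ *-congˡ xy≈0 ⟩
    x⁻¹ * 0#         ≈⟨ zeroʳ x⁻¹ ⟩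
    0#               ∎)

  ∏-nonzero : ∀ {k} (t : Vector Carrier k) → (∀ i → t i ≉ 0#) → ∏ t ≉ 0#
  ∏-nonzero {zero}  t t≉0 = 1≉0
  ∏-nonzero {suc k} t t≉0 = *-nonzero (t≉0 zero) (∏-nonzero (t ∘ suc) (t≉0 ∘ suc))

  ∏-zero : ∀ {k} (t : Vector Carrier k) i → t i ≈ 0# → ∏ t ≈ 0#
  ∏-zero {suc k} t i tᵢ≈0 = trans (∏-remove {i = i} t) (trans (*-congʳ tᵢ≈0) (zeroˡ _))

  nonzero : Vector Carrier q
  nonzero i = size.to (punchIn (size.from 0#) i)

  χ₀ : Carrier → Carrier
  χ₀ s = ∏ (λ i → s - nonzero i)

  χ₀-vanishes : ∀ {s} → s ≉ 0# → χ₀ s ≈ 0#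
  χ₀-vanishes {s} s≉0 = ∏-zero (λ i → s - nonzero i) i (trans (+-congˡ (-‿cong nonzero-i≈s)) (-‿inverseʳ s))
    where
    0≢s : size.from 0# ≢ size.from s
    0≢s e = s≉0 (Injection.injective from-injection (≡.sym e))
    i : Fin q
    i = punchOut 0≢s
    nonzero-i≈s : nonzero i ≈ s
    nonzero-i≈s = trans (reflexive (≡.cong size.to (punchIn-punchOut 0≢s))) (size.strictlyInverseˡ s)

  χ₀-at-zero : ∀ {s} → s ≈ 0# → χ₀ s ≉ 0#
  χ₀-at-zero {s} s≈0 = ∏-nonzero (λ i → s - nonzero i) λ i s-cᵢ≈0 →
    punchInᵢ≢i (size.from 0#) i (≡.trans (≡.sym (size.strictlyInverseʳ _))
      (size.from-cong (trans (sym (x∙y⁻¹≈ε⇒x≈y s (nonzero i) s-cᵢ≈0)) s≈0)))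

module Geometry (R : CommutativeRing 0ℓ 0ℓ) (n : ℕ) where
  open CommutativeRing R hiding (zero)
  open import Algebra.Properties.Semiring.Sum semiring
  open import Algebra.Properties.Ring ring using (-‿distribˡ-*; -‿distribʳ-*; -‿involutive)
  open import Algebra.Solver.Ring.NaturalCoefficients.Default commutativeSemiring using (solve; _:=_; _:+_; _:*_)
  open import Relation.Binary.Reasoning.Setoid setoid
  open VectorSpace R n using (Vec; _-ᵥ_; ⟨_,_⟩; sumF)
  open Polynomials R using (affine)

  sumF≡∑ : ∀ m (t : Vector Carrier m) → sumF m t ≡ ∑[ i < m ] t i
  sumF≡∑ zero    t = ≡.refl
  sumF≡∑ (suc m) t = ≡.cong (t zero +_) (sumF≡∑ m (t ∘ suc))

  -- Through x ↦ (⟨x,x⟩, x) the quadratic function x ↦ ⟨y - x, a - x⟩ becomes affine.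
  lift : Vec → Vector Carrier (suc n)
  lift x = ⟨ x , x ⟩ Vector.∷ x

  direction : Vec → Vec → Vector Carrier (suc n)
  direction y a = 1# Vector.∷ (λ i → - (y i + a i))

  -x*-x≈x*x : ∀ x → - x * - x ≈ x * x
  -x*-x≈x*x x = trans (sym (-‿distribˡ-* x (- x))) (trans (-‿cong (sym (-‿distribʳ-* x x))) (-‿involutive (x * x)))

  [y-x][a-x] : ∀ y a x → (y - x) * (a - x) ≈ y * a + (x * x + - (y + a) * x)
  [y-x][a-x] y a x = trans (expand y a (- x))
    (+-congˡ (+-cong (-x*-x≈x*x x) (trans (sym (-‿distribʳ-* (y + a) x)) (-‿distribˡ-* (y + a) x))))
    where
    expand : ∀ y a x′ → (y + x′) * (a + x′) ≈ y * a + (x′ * x′ + (y + a) * x′)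
    expand = solve 3 (λ y a x′ → (y :+ x′) :* (a :+ x′) := y :* a :+ (x′ :* x′ :+ (y :+ a) :* x′)) refl

  ⟨-,-⟩≈affine : ∀ y a x → ⟨ y -ᵥ x , a -ᵥ x ⟩ ≈ affine (direction y a) ⟨ y , a ⟩ (lift x)
  ⟨-,-⟩≈affine y a x = begin
    ⟨ y -ᵥ x , a -ᵥ x ⟩                                          ≡⟨ sumF≡∑ n _ ⟩
    ∑[ i < n ] ((y i - x i) * (a i - x i))                        ≈⟨ sum-cong-≋ {n} (λ i → [y-x][a-x] (y i) (a i) (x i)) ⟩
    ∑[ i < n ] (y i * a i + (x i * x i + - (y i + a i) * x i))    ≈⟨ ∑-distrib-+ (λ i → y i * a i) _ ⟩
    ∑[ i < n ] (y i * a i) + ∑[ i < n ] (x i * x i + - (y i + a i) * x i)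
      ≈⟨ +-congˡ (∑-distrib-+ (λ i → x i * x i) (λ i → - (y i + a i) * x i)) ⟩
    ∑[ i < n ] (y i * a i) + (∑[ i < n ] (x i * x i) + ∑[ i < n ] (- (y i + a i) * x i))
      ≈⟨ +-cong (reflexive (≡.sym (sumF≡∑ n _))) (+-congʳ (trans (reflexive (≡.sym (sumF≡∑ n _))) (sym (*-identityˡ _)))) ⟩
    affine (direction y a) ⟨ y , a ⟩ (lift x)                     ∎

  ⟨-,a-a⟩≈0 : ∀ y a → ⟨ y -ᵥ a , a -ᵥ a ⟩ ≈ 0#
  ⟨-,a-a⟩≈0 y a = trans (reflexive (sumF≡∑ n _)) (LinearAlgebra.∑-zero R _ (λ i → trans (*-congˡ (-‿inverseʳ (a i))) (zeroʳ _)))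

module RightAngleFree (R : CommutativeRing 0ℓ 0ℓ) (isField : IsField R) {q} (size : HasSize R (suc q)) (n : ℕ) where
  open CommutativeRing R hiding (zero)
  open VectorSpace R n using (Vec; VecSetoid; _≈ᵥ_; ⟨_,_⟩; Unique; NoRightAngle)
  open LinearAlgebra R using (diagonal-bound)
  open Polynomials R using (monomial; monomialCount; Poly; affine; Poly-∏affine)
  open FiniteField R isField size using (≈0?; 1≉0; *-nonzero; nonzero; χ₀; χ₀-vanishes; χ₀-at-zero)
  open Geometry R n using (lift; direction; ⟨-,-⟩≈affine; ⟨-,a-a⟩≈0)
  open import Data.List.Relation.Unary.Any using (here)

  card-bound : (A : List Vec) → Unique A → NoRightAngle A → length A ℕ.≤ suc (monomialCount (suc n) q)
  card-bound []      _    _       = z≤n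
  card-bound (y ∷ B) uniq noRight =
    s≤s (diagonal-bound ≈0? 1≉0 *-nonzero (monomial (suc n) q) f (lift ∘ P) f-poly off diag)
    where
    A : List Vec
    A = y ∷ B
    P : Fin (length B) → Vec
    P b = lookup A (suc b)

    distinct : ∀ {i j} → i ≢ j → ¬ (lookup A i ≈ᵥ lookup A j)
    distinct i≢j = i≢j ∘ lookup-injective VecSetoid uniq

    f : Fin (length B) → Vector Carrier (suc n) → Carrier
    f a = χ₀ ∘ affine (direction y (P a)) ⟨ y , P a ⟩
    f-poly : ∀ a → Poly (suc n) q (f a)
    f-poly a = Poly-∏affine (direction y (P a)) ⟨ y , P a ⟩ nonzero

    off : ∀ a b → b ≢ a → f a (lift (P b)) ≈ 0#
    off a b b≢a = χ₀-vanishes λ e →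
      noRight (P b) (P a) y (∈-lookup VecSetoid A (suc b)) (∈-lookup VecSetoid A (suc a)) (here (λ _ → refl))
        (distinct (b≢a ∘ suc-injective)) (distinct {suc a} {zero} λ ()) (distinct {suc b} {zero} λ ())
        (trans (⟨-,-⟩≈affine y (P a) (P b)) e)

    diag : ∀ a → f a (lift (P a)) ≉ 0#
    diag a = χ₀-at-zero (trans (sym (⟨-,-⟩≈affine y (P a) (P a))) (⟨-,a-a⟩≈0 y (P a)))

open import Data.Nat using (_≤_; _+_; _∸_; _%_)

-- The hypotheses on q and n only serve to exclude q = 0: the argument gives the bound with + 1 over any finite field.
theorem5 : (q : ℕ) → IsPrimePower q → q % 2 ≡ 1 →
    (R : CommutativeRing 0ℓ 0ℓ) → IsField R → HasSize R q →
    (n : ℕ) → 1 ≤ n →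
    (A : List (VectorSpace.Vec R n)) → VectorSpace.Unique R n A →
    VectorSpace.NoRightAngle R n A →
    length A ≤ ((n + q) C (q ∸ 1)) + 3
theorem5 zero    _ () _ _ _ _ _ _ _ _
theorem5 (suc q) _ _ R isField size n _ A uniq noRight = begin
  length A                             ≤⟨ RightAngleFree.card-bound R isField size n A uniq noRight ⟩
  suc (monomialCount (suc n) q)        ≡⟨ ≡.cong suc (monomialCount≡C (suc n) q) ⟩
  suc ((suc n + q) C q)                ≡⟨ ≡.cong (λ m → suc (m C q)) (ℕ.+-suc n q) ⟨
  suc ((n + suc q) C q)                ≡⟨ ℕ.+-comm 1 _ ⟩
  (n + suc q) C q + 1                  ≤⟨ ℕ.+-monoʳ-≤ ((n + suc q) C q) (s≤s z≤n) ⟩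
  (n + suc q) C q + 3                  ∎
  where
  open ℕ.≤-Reasoning
  open Polynomials R using (monomialCount; monomialCount≡C)
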